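{- Consider a Bounded Knapsack Problem instance with items $I=\{1,\dots,n\}$, where item $i$ has positive integer profit $p_i$, positive integer weight $w_i$ and positive integer availability $d_i$, and the knapsack has positive integer capacity $W$. The items are indexed in non-increasing order of efficiency $p_i/w_i$, $b$ is the break item, $I_{\text{left}}=\{i\in I: i<b\}$, $z$ is an integer (incumbent value), and $u\in\mathbb{Z}^n$ with $0\le u_i\le d_i$ is an unfixed availability vector (all as defined in the context). Let $I_{\text{res}}=\{i\in I: u_i>0\}$ (assumed nonempty) and let $\gcd(I_{\text{res}})$ be the greatest common divisor of the weights $\{w_i: i\in I_{\text{res}}\}$. Define $$\tilde W = W-\sum_{i\in I_{\text{left}}}(d_i-u_i)w_i,\qquad \overline W=\sum_{i\in I_{\text{left}}}(d_i-u_i)w_i+\left\lfloor \frac{\tilde W}{\gcd(I_{\text{res}})}\right\rfloor \gcd(I_{\text{res}}).$$ If an improved solution exists, then for each $i\in I_{\text{left}}$ it contains (at least) $d_i-u_i$ copies of $i$, and it has total weight $\sum_{i}w_ix_i\le \overline W$. Consequently, the knapsack capacity $W$ can be replaced by $\overline W$ without losing any improved solution.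
   Context: A solution of the instance is an integer vector $x=(x_1,\dots,x_n)$ with $0\le x_i\le d_i$ for all $i$ and $\sum_i w_ix_i\le W$; its value is $\sum_i p_ix_i$. The break item $b$ is the index with $\sum_{i=1}^{b-1}d_iw_i\le W<\sum_{i=1}^{b}d_iw_i$. Items $i<b$ are called left items and items $i\ge b$ right items. Given the incumbent value $z$, an improved solution is a solution with value at least $z+1$. The unfixed availability vector $u$ is assumed to have the property that every improved solution $x$ satisfies $d_i-u_i\le x_i\le d_i$ for every left item $i$ and $0\le x_i\le u_i$ for every right item $i$. -}

module Defs where

open import Data.Nat using (ℕ; zero; suc; _+_; _*_; _∸_; _≤_; _<_)
open import Data.Nat.DivMod using (_/_)
open import Data.Nat.GCD using (gcd)
open import Data.Fin using (Fin; toℕ)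
open import Data.Nat.ListAction using (sum)
open import Data.List using (List; map; foldr; filter; allFin)
open import Data.Integer using (ℤ; +_) renaming (_≤_ to _≤ℤ_; _+_ to _+ℤ_)
open import Data.Product using (_×_)
open import Relation.Unary using (Decidable)
import Data.Nat as ℕ
import Data.Fin as F

Σ : {n : ℕ} → (Fin n → ℕ) → ℕ
Σ {n} f = sum (map f (allFin n))

ΣOver : {n : ℕ} {P : Fin n → Set} → Decidable P → (Fin n → ℕ) → ℕ
ΣOver {n} P? f = sum (map f (filter P? (allFin n)))

-- Items indexed by non-increasing efficiency p_i / w_i (cross-multiplied).
SortedByEfficiency : {n : ℕ} → (p w : Fin n → ℕ) → Set
SortedByEfficiency p w = ∀ i j → toℕ i < toℕ j → p j * w i ≤ p i * w j

IsBreakItem : {n : ℕ} → (w d : Fin n → ℕ) → ℕ → Fin n → Set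
IsBreakItem w d W b =
  ΣOver (F._<? b) (λ i → d i * w i) ≤ W ×
  W < ΣOver (λ i → i F.≤? b) (λ i → d i * w i)

weight : {n : ℕ} → (w x : Fin n → ℕ) → ℕ
weight w x = Σ (λ i → w i * x i)

value : {n : ℕ} → (p x : Fin n → ℕ) → ℕ
value p x = Σ (λ i → p i * x i)

IsSolution : {n : ℕ} → (w d : Fin n → ℕ) → ℕ → (Fin n → ℕ) → Set
IsSolution w d W x = (∀ i → x i ≤ d i) × weight w x ≤ W

IsImproved : {n : ℕ} → (p w d : Fin n → ℕ) → ℕ → ℤ → (Fin n → ℕ) → Set
IsImproved p w d W z x = IsSolution w d W x × (z +ℤ + 1) ≤ℤ + value p x

-- The standing property of the unfixed availability vector u w.r.t. break item b.
UnfixedProperty : {n : ℕ} → (p w d : Fin n → ℕ) → ℕ → ℤ → Fin n → (Fin n → ℕ) → Set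
UnfixedProperty p w d W z b u =
  ∀ x → IsImproved p w d W z x →
    (∀ i → toℕ i < toℕ b → (d i ∸ u i ≤ x i) × (x i ≤ d i)) ×
    (∀ i → toℕ b ≤ toℕ i → x i ≤ u i)

gcdRes : {n : ℕ} → (w u : Fin n → ℕ) → ℕ
gcdRes {n} w u = foldr gcd 0 (map w (filter (λ i → 0 ℕ.<? u i) (allFin n)))

-- ⌊a / g⌋ * g  (g = 0 never occurs in the lemma; value 0 there is an arbitrary convention).
roundDown : ℕ → ℕ → ℕ
roundDown a zero = 0
roundDown a (suc k) = (a / suc k) * suc k

leftFixedWeight : {n : ℕ} → (w d u : Fin n → ℕ) → Fin n → ℕ
leftFixedWeight w d u b = ΣOver (F._<? b) (λ i → (d i ∸ u i) * w i)

W̃ : {n : ℕ} → (w d u : Fin n → ℕ) → ℕ → Fin n → ℕ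
W̃ w d u W b = W ∸ leftFixedWeight w d u b

W̄ : {n : ℕ} → (w d u : Fin n → ℕ) → ℕ → Fin n → ℕ
W̄ w d u W b = leftFixedWeight w d u b + roundDown (W̃ w d u W b) (gcdRes w u)

-- Every improved solution x contains the d_i − u_i copies of each left item that
-- are fixed by u.  Removing them leaves a free part y with y_i ≤ u_i, so y only
-- uses items of I_res, whose weights are all multiples of g = gcd(I_res).  The
-- free weight is therefore a multiple of g that fits into W̃, hence it is at most
-- ⌊W̃ / g⌋ g.
module Submission where

open import Defs
open import Data.Nat using (ℕ; _≤_; _<_; _<?_; _∸_; zero; suc; _+_; _*_; z≤n; s≤s)
open import Data.Nat.Properties
open import Data.Nat.Divisibility
open import Data.Nat.DivMod using (_/_; m*n/n≡m; /-monoˡ-≤)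
open import Data.Nat.GCD using (gcd; gcd[m,n]∣m; gcd[m,n]∣n)
open import Data.Nat.ListAction using (sum)
open import Data.List using (List; []; _∷_; map; foldr; filter; allFin)
open import Data.List.Properties using (map-cong)
open import Data.List.Membership.Propositional using (_∈_)
open import Data.List.Membership.Propositional.Properties using (∈-map⁺; ∈-filter⁺; ∈-allFin)
open import Data.List.Relation.Unary.Any using (here; there)
open import Data.Fin using (Fin; toℕ)
import Data.Fin as F
open import Data.Integer using (ℤ)
open import Data.Product using (_×_; ∃; _,_; proj₁; proj₂)
open import Relation.Nullary using (yes; no; ¬_; contradiction)
open import Relation.Unary using (Decidable)
open import Relation.Binary.PropositionalEquality
open import Algebra.Properties.CommutativeSemigroup +-commutativeSemigroup
  using () renaming (interchange to +-interchange)

module _ {A : Set} where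

  sum-map-+ : (f g : A → ℕ) (xs : List A) →
    sum (map (λ a → f a + g a) xs) ≡ sum (map f xs) + sum (map g xs)
  sum-map-+ f g [] = refl
  sum-map-+ f g (x ∷ xs) = begin
    f x + g x + sum (map (λ a → f a + g a) xs)    ≡⟨ cong (f x + g x +_) (sum-map-+ f g xs) ⟩
    f x + g x + (sum (map f xs) + sum (map g xs)) ≡⟨ +-interchange (f x) (g x) _ _ ⟩
    f x + sum (map f xs) + (g x + sum (map g xs)) ∎
    where open ≡-Reasoning

  sum-map-filter : {P : A → Set} (P? : Decidable P) (f g : A → ℕ) →
    (∀ a → P a → f a ≡ g a) → (∀ a → ¬ P a → g a ≡ 0) → (xs : List A) →
    sum (map f (filter P? xs)) ≡ sum (map g xs)
  sum-map-filter P? f g f≡g g≡0 [] = refl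
  sum-map-filter P? f g f≡g g≡0 (x ∷ xs) with P? x
  ... | yes Px = cong₂ _+_ (f≡g x Px) (sum-map-filter P? f g f≡g g≡0 xs)
  ... | no ¬Px = trans (sum-map-filter P? f g f≡g g≡0 xs) (cong (_+ sum (map g xs)) (sym (g≡0 x ¬Px)))

  ∣-sum-map : ∀ {m} (f : A → ℕ) → (∀ a → m ∣ f a) → (xs : List A) → m ∣ sum (map f xs)
  ∣-sum-map f m∣f []       = _ ∣0
  ∣-sum-map f m∣f (x ∷ xs) = ∣m∣n⇒∣m+n (m∣f x) (∣-sum-map f m∣f xs)

foldr-gcd-∣ : ∀ {m} (ms : List ℕ) → m ∈ ms → foldr gcd 0 ms ∣ m
foldr-gcd-∣ (m ∷ ms) (here refl) = gcd[m,n]∣m m (foldr gcd 0 ms)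
foldr-gcd-∣ (k ∷ ms) (there m∈ms) =
  ∣-trans (gcd[m,n]∣n k (foldr gcd 0 ms)) (foldr-gcd-∣ ms m∈ms)

roundDown-greatest : ∀ g {m a} → g ∣ m → m ≤ a → m ≤ roundDown a g
roundDown-greatest zero    g∣m _ rewrite 0∣⇒≡0 g∣m = z≤n
roundDown-greatest (suc k) {a = a} (divides q refl) q*g≤a =
  *-monoˡ-≤ (suc k) (subst (_≤ a / suc k) (m*n/n≡m q (suc k)) (/-monoˡ-≤ (suc k) q*g≤a))

fixedLeft : {n : ℕ} → Fin n → (d u : Fin n → ℕ) → Fin n → ℕ
fixedLeft b d u i with i F.<? b
... | yes _ = d i ∸ u i
... | no _  = 0

module _ {n : ℕ} (b : Fin n) (d u x : Fin n → ℕ) where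

  fixedLeft-≤ : (∀ i → toℕ i < toℕ b → d i ∸ u i ≤ x i) → ∀ i → fixedLeft b d u i ≤ x i
  fixedLeft-≤ lower i with i F.<? b
  ... | yes i<b = lower i i<b
  ... | no _    = z≤n

  ∸-fixedLeft-≤ : (∀ i → u i ≤ d i) → (∀ i → toℕ i < toℕ b → x i ≤ d i) →
    (∀ i → toℕ b ≤ toℕ i → x i ≤ u i) → ∀ i → x i ∸ fixedLeft b d u i ≤ u i
  ∸-fixedLeft-≤ u≤d left≤d right≤u i with i F.<? b
  ... | yes i<b = subst (x i ∸ (d i ∸ u i) ≤_) (m∸[m∸n]≡n (u≤d i)) (∸-monoˡ-≤ (d i ∸ u i) (left≤d i i<b))
  ... | no i≮b  = right≤u i (≮⇒≥ i≮b)

module _ {n : ℕ} (w : Fin n → ℕ) where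

  weight-∸ : (x c : Fin n → ℕ) → (∀ i → c i ≤ x i) →
    weight w x ≡ weight w (λ i → x i ∸ c i) + weight w c
  weight-∸ x c c≤x = trans (cong sum (map-cong split (allFin n)))
                           (sum-map-+ (λ i → w i * (x i ∸ c i)) (λ i → w i * c i) (allFin n))
    where
    split : ∀ i → w i * x i ≡ w i * (x i ∸ c i) + w i * c i
    split i = trans (cong (w i *_) (sym (m∸n+n≡m (c≤x i)))) (*-distribˡ-+ (w i) _ _)

  gcdRes-∣ : (u : Fin n → ℕ) (i : Fin n) → 0 < u i → gcdRes w u ∣ w i
  gcdRes-∣ u i 0<uᵢ = foldr-gcd-∣ _ (∈-map⁺ w (∈-filter⁺ (λ j → 0 <? u j) (∈-allFin i) 0<uᵢ))

  gcdRes-∣-weight : (u y : Fin n → ℕ) → (∀ i → y i ≤ u i) → gcdRes w u ∣ weight w y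
  gcdRes-∣-weight u y y≤u = ∣-sum-map (λ i → w i * y i) ∣wᵢyᵢ (allFin n)
    where
    ∣wᵢyᵢ : ∀ i → gcdRes w u ∣ w i * y i
    ∣wᵢyᵢ i with u i in uᵢ≡ | y≤u i
    ... | zero  | yᵢ≤0 = subst (gcdRes w u ∣_)
      (sym (trans (cong (w i *_) (n≤0⇒n≡0 yᵢ≤0)) (*-zeroʳ (w i)))) (_ ∣0)
    ... | suc _ | _    = ∣-trans (gcdRes-∣ u i (subst (0 <_) (sym uᵢ≡) (s≤s z≤n))) (m∣m*n (y i))

  weight-fixedLeft : (b : Fin n) (d u : Fin n → ℕ) →
    weight w (fixedLeft b d u) ≡ leftFixedWeight w d u b
  weight-fixedLeft b d u =
    sym (sum-map-filter (F._<? b) (λ i → (d i ∸ u i) * w i) (λ i → w i * fixedLeft b d u i)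
                        fixed fixed≡0 (allFin n))
    where
    fixed : ∀ i → toℕ i < toℕ b → (d i ∸ u i) * w i ≡ w i * fixedLeft b d u i
    fixed i i<b with i F.<? b
    ... | yes _   = *-comm (d i ∸ u i) (w i)
    ... | no i≮b  = contradiction i<b i≮b
    fixed≡0 : ∀ i → ¬ toℕ i < toℕ b → w i * fixedLeft b d u i ≡ 0
    fixed≡0 i i≮b with i F.<? b
    ... | yes i<b = contradiction i<b i≮b
    ... | no _    = *-zeroʳ (w i)

lemma1 : (n : ℕ) (p w d : Fin n → ℕ) (W : ℕ) →
    (∀ i → 0 < p i) → (∀ i → 0 < w i) → (∀ i → 0 < d i) → 0 < W →
    SortedByEfficiency p w →
    (b : Fin n) → IsBreakItem w d W b →
    (z : ℤ) (u : Fin n → ℕ) → (∀ i → u i ≤ d i) →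
    UnfixedProperty p w d W z b u →
    ∃ (λ i → 0 < u i) →
    (x : Fin n → ℕ) → IsImproved p w d W z x →
    (∀ i → toℕ i < toℕ b → d i ∸ u i ≤ x i) ×
    weight w x ≤ W̄ w d u W b
lemma1 n p w d W _ _ _ _ _ b _ z u u≤d unfixed _ x improved = fixed≤x , weight≤W̄
  where
  left-bounds : ∀ i → toℕ i < toℕ b → (d i ∸ u i ≤ x i) × (x i ≤ d i)
  left-bounds = proj₁ (unfixed x improved)
  fixed≤x : ∀ i → toℕ i < toℕ b → d i ∸ u i ≤ x i
  fixed≤x i i<b = proj₁ (left-bounds i i<b)
  L : ℕ
  L = leftFixedWeight w d u b
  y : Fin n → ℕ
  y i = x i ∸ fixedLeft b d u i
  weight≡ : weight w x ≡ weight w y + L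
  weight≡ = trans (weight-∸ w x (fixedLeft b d u) (fixedLeft-≤ b d u x fixed≤x))
                  (cong (weight w y +_) (weight-fixedLeft w b d u))
  y≤u : ∀ i → y i ≤ u i
  y≤u = ∸-fixedLeft-≤ b d u x u≤d (λ i i<b → proj₂ (left-bounds i i<b)) (proj₂ (unfixed x improved))
  weight≤W̄ : weight w x ≤ W̄ w d u W b
  weight≤W̄ = begin
    weight w x      ≡⟨ trans weight≡ (+-comm (weight w y) L) ⟩
    L + weight w y  ≤⟨ +-monoʳ-≤ L (roundDown-greatest (gcdRes w u) (gcdRes-∣-weight w u y y≤u)
                         (m+n≤o⇒m≤o∸n (weight w y) (subst (_≤ W) weight≡ (proj₂ (proj₁ improved))))) ⟩
    W̄ w d u W b     ∎
    where open ≤-Reasoning
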